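{- Let $\mathcal{M}$ be a unitary magma. The set-operad $\mathrm{C}\mathcal{M}$ is basic if and only if $\mathcal{M}$ is right cancellable, i.e., for all $a,b,c\in\mathcal{M}$, $a\star c=b\star c$ implies $a=b$.
   Context: A unitary magma is a set $\mathcal{M}$ with a binary operation $\star$ admitting a two-sided unit $\mathds{1}_\mathcal{M}$. For $n\geq 1$, an $\mathcal{M}$-clique of size $n$ is a complete graph $\mathfrak{p}$ on the vertex set $[n+1]$ with a labeling of each arc $(x,y)$, $1\le x<y\le n+1$, by $\mathfrak{p}(x,y)\in\mathcal{M}$; $(1,n+1)$ is the base and $(i,i+1)$ the $i$-th edge. The set-operad $\mathrm{C}\mathcal{M}$ has in arity $1$ only the clique $\mathbf{u}$ of size 1 with base labeled $\mathds{1}_\mathcal{M}$ (the unit), and in arity $n\ge2$ all $\mathcal{M}$-cliques of size $n$. For $\mathfrak{p}$ of size $n$, $\mathfrak{q}$ of size $m$, $i\in[n]$, $\mathfrak{p}\circ_i\mathfrak{q}$ is the $\mathcal{M}$-clique of size $n+m-1$ obtained by gluing the base of $\mathfrak{q}$ onto the $i$-th edge of $\mathfrak{p}$: vertex $x$ of $\mathfrak{p}$ becomes $x$ if $x\le i$ and $x+m-1$ if $x\ge i+1$, vertex $y$ of $\mathfrak{q}$ becomes $y+i-1$; arcs of $\mathfrak{p}$ other than its $i$-th edge and arcs of $\mathfrak{q}$ other than its base keep their labels, the arc $(i,i+m)$ gets label $\mathfrak{p}(i,i+1)\star\mathfrak{q}(1,m+1)$, and all other arcs get $\mathds{1}_\mathcal{M}$.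 A set-operad $\mathcal{O}$ is basic if for every $y\in\mathcal{O}$ of arity $|y|$, every $n$ and every valid $i$, the map $\mathcal{O}(n)\to\mathcal{O}(n+|y|-1)$, $x\mapsto x\circ_i y$, is injective. -}

module Defs where

open import Data.Nat using (ℕ; zero; suc; _+_; _∸_; _≤_; _<_; _≤ᵇ_; _<ᵇ_; _≡ᵇ_)
open import Data.Bool using (Bool; true; false; if_then_else_; _∧_; _∨_)
open import Relation.Binary.PropositionalEquality using (_≡_)

record UnitaryMagma : Set₁ where
  field
    Carrier : Set
    _⋆_     : Carrier → Carrier → Carrier
    𝟙       : Carrier
    identityˡ : ∀ a → 𝟙 ⋆ a ≡ a
    identityʳ : ∀ a → a ⋆ 𝟙 ≡ a

module _ (M : UnitaryMagma) where
  open UnitaryMagma M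

  RightCancellable : Set
  RightCancellable = ∀ a b c → a ⋆ c ≡ b ⋆ c → a ≡ b

  -- An M-clique of size n is the restriction of a labeling
  -- ℓ : ℕ → ℕ → Carrier to the arcs (x , y) with 1 ≤ x < y ≤ n + 1
  -- (vertices are 1-based, as in the paper); values elsewhere are irrelevant.
  Labeling : Set
  Labeling = ℕ → ℕ → Carrier

  SameClique : ℕ → Labeling → Labeling → Set
  SameClique n p q = ∀ x y → 1 ≤ x → x < y → y ≤ suc n → p x y ≡ q x y

  -- Elements of the set-operad CM in arity n:
  -- arity 0 is empty, arity 1 contains only the clique u with base labeled 𝟙,
  -- arity n ≥ 2 contains all M-cliques of size n.
  record CM (n : ℕ) : Set where
    constructor mkCM
    field
      clique   : Labeling
      arity≥1  : 1 ≤ n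
      unitBase : n ≡ 1 → clique 1 2 ≡ 𝟙
  open CM public

  _≈CM_ : ∀ {n} → CM n → CM n → Set
  _≈CM_ {n} p q = SameClique n (clique p) (clique q)

  -- Partial composition p ∘ᵢ q of a clique p of size n with a clique q of
  -- size m, giving a clique of size n + m - 1 (gluing the base of q on the
  -- i-th edge of p).  Vertex v of p goes to v if v ≤ i and to v + m - 1 if
  -- v ≥ i + 1; vertex w of q goes to w + i - 1.
  compose : (n m i : ℕ) → Labeling → Labeling → Labeling
  compose n m i p q x y =
    if (x ≡ᵇ i) ∧ (y ≡ᵇ i + m) then p i (suc i) ⋆ q 1 (suc m)
    else if (i ≤ᵇ x) ∧ (y ≤ᵇ i + m) then q (suc (x ∸ i)) (suc (y ∸ i))
    else if isP x ∧ isP y then p (pre x) (pre y)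
    else 𝟙
    where
      isP : ℕ → Bool
      isP v = (v ≤ᵇ i) ∨ (i + m ≤ᵇ v)
      pre : ℕ → ℕ
      pre v = if v ≤ᵇ i then v else v ∸ (m ∸ 1)

  _∘[_]_ : ∀ {n m} → CM n → ℕ → CM m → Labeling
  _∘[_]_ {n} {m} p i q = compose n m i (clique p) (clique q)

  IsBasic : Set
  IsBasic = ∀ {k} (y : CM k) (n i : ℕ) → 1 ≤ i → i ≤ n →
            ∀ (x x′ : CM n) →
            SameClique (n + k ∸ 1) (x ∘[ i ] y) (x′ ∘[ i ] y) →
            x ≈CM x′

module Submission where

-- (⇒) Let x_a be the clique of size 2 whose first edge is labelled a and whose
-- other arcs are labelled 𝟙, and y the clique of size 2 all of whose arcs are
-- labelled c.  The six arcs of x_a ∘₁ y carry the same labels as those of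
-- x_b ∘₁ y, except the glued arc (1,3), which carries a ⋆ c resp. b ⋆ c.  So
-- a ⋆ c = b ⋆ c makes the composites equal, basicness gives x_a = x_b, and
-- reading the first edge gives a = b.
--
-- (⇐) In p ∘ᵢ q, with q of arity k + 1, vertex w of p sits at position
-- embed i k w (w if w ≤ i, w + k otherwise).  Every arc (u,v) of p has an image
-- arc inside the composite, whose label is p(u,v) itself, except for the i-th
-- edge, whose image (i, i + k + 1) is labelled p(i,i+1) ⋆ q(base).  Hence if
-- x ∘ᵢ y = x′ ∘ᵢ y, every label of x equals that of x′, after cancelling the
-- common right factor y(base) on the i-th edge.

open import Defs
open import Data.Product using (_×_; _,_)
open import Data.Sum using (_⊎_; inj₁; inj₂)
open import Data.Nat using (ℕ; zero; suc; _+_; _∸_; _≤_; _<_; _≤ᵇ_; _≡ᵇ_; z≤n; s≤s; s≤s⁻¹; _≤?_; _≟_)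
open import Data.Nat.Properties
open import Data.Bool using (if_then_else_)
open import Relation.Nullary using (¬_; yes; no)
open import Relation.Nullary.Decidable using (dec-true; dec-false; _×-dec_; _⊎-dec_)
open import Relation.Binary.PropositionalEquality

-- Position of vertex w of p inside a composite p ∘ᵢ q, where q has arity k + 1.
embed : ℕ → ℕ → ℕ → ℕ
embed i k w = if w ≤ᵇ i then w else w + k

-- Inverse of embed on its image (the map `pre` used in the definition of compose).
restore : ℕ → ℕ → ℕ → ℕ
restore i k w = if w ≤ᵇ i then w else w ∸ k

embed-left : ∀ {i k w} → w ≤ i → embed i k w ≡ w
embed-left {i} {k} {w} w≤i rewrite dec-true (w ≤? i) w≤i = refl

embed-right : ∀ {i k w} → i < w → embed i k w ≡ w + k
embed-right {i} {k} {w} i<w rewrite dec-false (w ≤? i) (<⇒≱ i<w) = refl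

restore-embed : ∀ i k w → restore i k (embed i k w) ≡ w
restore-embed i k w with ≤-<-connex w i
... | inj₁ w≤i rewrite embed-left {k = k} w≤i | dec-true (w ≤? i) w≤i = refl
... | inj₂ i<w rewrite embed-right {k = k} i<w
                     | dec-false (w + k ≤? i) (<⇒≱ (<-≤-trans i<w (m≤m+n w k))) = m+n∸n≡m w k

embed-outside : ∀ i k w → embed i k w ≤ i ⊎ i + suc k ≤ embed i k w
embed-outside i k w with ≤-<-connex w i
... | inj₁ w≤i rewrite embed-left {k = k} w≤i = inj₁ w≤i
... | inj₂ i<w rewrite embed-right {k = k} i<w | +-suc i k = inj₂ (+-monoˡ-≤ k i<w)

embed-pos : ∀ {i k w} → 1 ≤ w → 1 ≤ embed i k w
embed-pos {i} {k} {w} 1≤w with ≤-<-connex w i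
... | inj₁ w≤i rewrite embed-left {k = k} w≤i = 1≤w
... | inj₂ i<w rewrite embed-right {k = k} i<w = ≤-trans 1≤w (m≤m+n w k)

embed-≤ : ∀ i k w → embed i k w ≤ w + k
embed-≤ i k w with ≤-<-connex w i
... | inj₁ w≤i rewrite embed-left {k = k} w≤i = m≤m+n w k
... | inj₂ i<w rewrite embed-right {k = k} i<w = ≤-refl

embed-mono : ∀ {i k u v} → u < v → embed i k u < embed i k v
embed-mono {i} {k} {u} {v} u<v with ≤-<-connex u i | ≤-<-connex v i
... | _ | inj₁ v≤i rewrite embed-left {k = k} v≤i
                         | embed-left {k = k} (≤-trans (<⇒≤ u<v) v≤i) = u<v
... | inj₁ u≤i | inj₂ i<v rewrite embed-left {k = k} u≤i
                                | embed-right {k = k} i<v = <-≤-trans u<v (m≤m+n v k)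
... | inj₂ i<u | inj₂ i<v rewrite embed-right {k = k} i<u
                                | embed-right {k = k} i<v = +-monoˡ-< k u<v

embed-not-inside : ∀ {i k u v} → u < v → ¬ (u ≡ i × v ≡ suc i) →
                   ¬ (i ≤ embed i k u × embed i k v ≤ i + suc k)
embed-not-inside {i} {k} {u} {v} u<v not-edge (i≤eu , ev≤end) with ≤-<-connex v i
... | inj₁ v≤i = <⇒≱ (<-≤-trans u<v v≤i) i≤u
  where
  i≤u : i ≤ u
  i≤u = subst (i ≤_) (embed-left {k = k} (≤-trans (<⇒≤ u<v) v≤i)) i≤eu
... | inj₂ i<v = not-edge (u≡i , v≡1+i)
  where
  v≡1+i : v ≡ suc i
  v≡1+i = ≤-antisym (+-cancelʳ-≤ k v (suc i)
            (subst₂ _≤_ (embed-right {k = k} i<v) (+-suc i k) ev≤end)) i<v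
  u≤i : u ≤ i
  u≤i = s≤s⁻¹ (subst (u <_) v≡1+i u<v)
  u≡i : u ≡ i
  u≡i = ≤-antisym u≤i (subst (i ≤_) (embed-left {k = k} u≤i) i≤eu)

composite-size : ∀ {n} k → 1 ≤ n → suc n + k ≡ suc (n + suc k ∸ 1)
composite-size {suc n} k _ = cong suc (sym (+-suc n k))

sameClique-size3 : ∀ (M : UnitaryMagma) {p q : Labeling M} →
  p 1 2 ≡ q 1 2 → p 1 3 ≡ q 1 3 → p 1 4 ≡ q 1 4 →
  p 2 3 ≡ q 2 3 → p 2 4 ≡ q 2 4 → p 3 4 ≡ q 3 4 → SameClique M 3 p q
sameClique-size3 M e12 e13 e14 e23 e24 e34 = arc
  where
  arc : SameClique M 3 _ _
  arc 1 2 _ _ _ = e12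
  arc 1 3 _ _ _ = e13
  arc 1 4 _ _ _ = e14
  arc 2 3 _ _ _ = e23
  arc 2 4 _ _ _ = e24
  arc 3 4 _ _ _ = e34
  arc 0 _ () _ _
  arc 1 0 _ () _
  arc 1 1 _ (s≤s ()) _
  arc 1 (suc (suc (suc (suc (suc _))))) _ _ (s≤s (s≤s (s≤s (s≤s ()))))
  arc 2 0 _ () _
  arc 2 1 _ (s≤s ()) _
  arc 2 2 _ (s≤s (s≤s ())) _
  arc 2 (suc (suc (suc (suc (suc _))))) _ _ (s≤s (s≤s (s≤s (s≤s ()))))
  arc 3 0 _ () _
  arc 3 1 _ (s≤s ()) _
  arc 3 2 _ (s≤s (s≤s ())) _
  arc 3 3 _ (s≤s (s≤s (s≤s ()))) _
  arc 3 (suc (suc (suc (suc (suc _))))) _ _ (s≤s (s≤s (s≤s (s≤s ()))))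
  arc (suc (suc (suc (suc _)))) _ _ (s≤s (s≤s (s≤s (s≤s (s≤s _))))) (s≤s (s≤s (s≤s (s≤s ()))))

module _ (M : UnitaryMagma) where
  open UnitaryMagma M

  compose-base : ∀ n m i (p q : Labeling M) {x y} → x ≡ i → y ≡ i + m →
                 compose M n m i p q x y ≡ p i (suc i) ⋆ q 1 (suc m)
  compose-base n m i p q {x} {y} x≡i y≡i+m
    rewrite dec-true ((x ≟ i) ×-dec (y ≟ i + m)) (x≡i , y≡i+m) = refl

  compose-outer : ∀ n k i (p q : Labeling M) {x y} →
    ¬ (i ≤ x × y ≤ i + suc k) → x ≤ i ⊎ i + suc k ≤ x → y ≤ i ⊎ i + suc k ≤ y →
    compose M n (suc k) i p q x y ≡ p (restore i k x) (restore i k y)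
  compose-outer n k i p q {x} {y} not-inside x-outer y-outer
    rewrite dec-false ((x ≟ i) ×-dec (y ≟ i + suc k))
                      (λ (x≡i , y≡end) → not-inside (≤-reflexive (sym x≡i) , ≤-reflexive y≡end))
          | dec-false ((i ≤? x) ×-dec (y ≤? i + suc k)) not-inside
          | dec-true ((x ≤? i) ⊎-dec (i + suc k ≤? x)) x-outer
          | dec-true ((y ≤? i) ⊎-dec (i + suc k ≤? y)) y-outer = refl

  compose-edge : ∀ n k i (p q : Labeling M) →
    compose M n (suc k) i p q (embed i k i) (embed i k (suc i)) ≡ p i (suc i) ⋆ q 1 (suc (suc k))
  compose-edge n k i p q =
    compose-base n (suc k) i p q (embed-left ≤-refl)
                 (trans (embed-right ≤-refl) (sym (+-suc i k)))

  compose-arc : ∀ n k i (p q : Labeling M) {u v} → u < v → ¬ (u ≡ i × v ≡ suc i) →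
    compose M n (suc k) i p q (embed i k u) (embed i k v) ≡ p u v
  compose-arc n k i p q {u} {v} u<v not-edge =
    trans (compose-outer n k i p q (embed-not-inside u<v not-edge)
                         (embed-outside i k u) (embed-outside i k v))
          (cong₂ p (restore-embed i k u) (restore-embed i k v))

  recover-label : RightCancellable M → ∀ n k i (p p′ q : Labeling M) {u v} → u < v →
    compose M n (suc k) i p q (embed i k u) (embed i k v) ≡
    compose M n (suc k) i p′ q (embed i k u) (embed i k v) →
    p u v ≡ p′ u v
  recover-label rc n k i p p′ q {u} {v} u<v same with (u ≟ i) ×-dec (v ≟ suc i)
  ... | yes (refl , refl) = rc _ _ (q 1 (suc (suc k))) (begin
          p i (suc i) ⋆ q 1 (suc (suc k))   ≡⟨ sym (compose-edge n k i p q) ⟩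
          image p                           ≡⟨ same ⟩
          image p′                          ≡⟨ compose-edge n k i p′ q ⟩
          p′ i (suc i) ⋆ q 1 (suc (suc k))  ∎)
    where
    open ≡-Reasoning
    image : Labeling M → Carrier
    image r = compose M n (suc k) i r q (embed i k u) (embed i k v)
  ... | no not-edge = begin
          p u v     ≡⟨ sym (compose-arc n k i p q u<v not-edge) ⟩
          image p   ≡⟨ same ⟩
          image p′  ≡⟨ compose-arc n k i p′ q u<v not-edge ⟩
          p′ u v    ∎
    where
    open ≡-Reasoning
    image : Labeling M → Carrier
    image r = compose M n (suc k) i r q (embed i k u) (embed i k v)

  rightCancellable⇒basic : RightCancellable M → IsBasic M
  rightCancellable⇒basic rc {zero} (mkCM _ () _)
  rightCancellable⇒basic rc {suc k} y n i 1≤i i≤n x x′ same u v 1≤u u<v v≤1+n =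
    recover-label rc n k i (clique x) (clique x′) (clique y) u<v
      (same (embed i k u) (embed i k v) (embed-pos 1≤u) (embed-mono u<v) image-in-range)
    where
    image-in-range : embed i k v ≤ suc (n + suc k ∸ 1)
    image-in-range = subst (embed i k v ≤_) (composite-size k (≤-trans 1≤i i≤n))
                       (≤-trans (embed-≤ i k v) (+-monoˡ-≤ k v≤1+n))

  firstEdgeLabelled : Carrier → CM M 2
  firstEdgeLabelled a = mkCM (λ _ v → if v ≡ᵇ 2 then a else 𝟙) (s≤s z≤n) (λ ())

  constantClique : Carrier → CM M 2
  constantClique c = mkCM (λ _ _ → c) (s≤s z≤n) (λ ())

  basic⇒rightCancellable : IsBasic M → RightCancellable M
  basic⇒rightCancellable basic a b c ac≡bc =
    basic (constantClique c) 2 1 ≤-refl (s≤s z≤n)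
          (firstEdgeLabelled a) (firstEdgeLabelled b) composites-agree
          1 2 ≤-refl ≤-refl (s≤s (s≤s z≤n))
    where
    composites-agree : SameClique M 3 (_∘[_]_ M (firstEdgeLabelled a) 1 (constantClique c))
                                      (_∘[_]_ M (firstEdgeLabelled b) 1 (constantClique c))
    composites-agree = sameClique-size3 M refl ac≡bc refl refl refl refl

proposition1p4 : (M : UnitaryMagma) → (IsBasic M → RightCancellable M) × (RightCancellable M → IsBasic M)
proposition1p4 M = basic⇒rightCancellable M , rightCancellable⇒basic M
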